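{- Let $I=(a..c)$ be a conserved interval of $\mathcal{P}$ and let $F=\{f_1,\ldots,f_k\}$ and $F'=\{f'_1,\ldots,f'_l\}$ be two sets of frontiers of $I$. Then $F\cup F'$ is also a set of frontiers of $I$.
   Context: Let $n\ge 2$, $K\ge1$, and let $\mathcal{P}=\{P_1,\ldots,P_K\}$ be a set of signed permutations of $\{1,\ldots,n\}$: each $P_k$ is a sequence in which each of $1,\ldots,n$ appears exactly once, with a sign $+$ or $-$. Assume each $P_k$ begins with $+1$ and ends with $+n$, and $P_1=\mathrm{Id}_n$ (identity order, all signs $+$). For $i\le j$, $(i..j)=\{i,\ldots,j\}$. A conserved interval of $\mathcal{P}$ is either a singleton, or a set $(a..c)$ with $a<c$ such that in every $P_k$ the elements of $(a..c)$ (ignoring signs) occupy consecutive positions and this block is delimited either by $+a$ on the left and $+c$ on the right, or by $-c$ on the left and $-a$ on the right. For a conserved interval $I=(a..c)$, a set $\{f_1,\ldots,f_k\}$ of elements with $a=f_1<f_2<\cdots<f_k=c$ is a set of frontiers of $I$ if $(f_i..f_j)$ is a conserved interval for all $1\le i<j\le k$. -}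

module Defs where

open import Data.Nat using (ℕ; zero; suc; _+_; _∸_; _≤_; _<_)
open import Data.Bool using (Bool; true; false)
open import Data.Product using (_×_; _,_; proj₂; ∃; ∃-syntax)
open import Data.Sum using (_⊎_)
open import Data.List using (List; []; _∷_; _++_; map; upTo; length)
open import Data.List.Membership.Propositional using (_∈_)
open import Data.List.Relation.Unary.All using (All)
open import Data.List.Relation.Binary.Permutation.Propositional using (_↭_)
open import Relation.Binary.PropositionalEquality using (_≡_)

-- A signed element: (sign , value), sign true = '+', false = '-'.
SElt : Set
SElt = Bool × ℕ

-- The list a, a+1, ..., c  (the interval (a..c)); empty-ish conventions irrelevant since used with a ≤ c.
range : ℕ → ℕ → List ℕ
range a c = map (a +_) (upTo (suc (c ∸ a)))

Id : ℕ → List SElt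
Id n = map (λ i → (true , i)) (range 1 n)

IsSignedPerm : ℕ → List SElt → Set
IsSignedPerm n P =
  (map proj₂ P ↭ range 1 n) ×
  (∃[ mid ] P ≡ (true , 1) ∷ (mid ++ (true , n) ∷ []))

BlockIn : ℕ → ℕ → List SElt → Set
BlockIn a c P =
  ∃[ pre ] ∃[ x ] ∃[ inner ] ∃[ y ] ∃[ suf ]
    (P ≡ pre ++ ((x ∷ inner) ++ (y ∷ suf))) ×
    (map proj₂ ((x ∷ inner) ++ (y ∷ [])) ↭ range a c) ×
    ((x ≡ (true , a) × y ≡ (true , c)) ⊎ (x ≡ (false , c) × y ≡ (false , a)))

Conserved : ℕ → List (List SElt) → ℕ → ℕ → Set
Conserved n 𝒫 a c =
  (a ≡ c × 1 ≤ a × a ≤ n) ⊎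
  (a < c × All (BlockIn a c) 𝒫)

IsFrontierSet : ℕ → List (List SElt) → ℕ → ℕ → (ℕ → Set) → Set
IsFrontierSet n 𝒫 a c F =
  F a × F c × (∀ x → F x → a ≤ x × x ≤ c) ×
  (∀ x y → F x → F y → x < y → Conserved n 𝒫 x y)

_∪_ : (ℕ → Set) → (ℕ → Set) → (ℕ → Set)
(F ∪ G) x = F x ⊎ G x

-- Take x ∈ F and y ∈ F′ with x < y. Then (a..y) is conserved (its ends lie in F′) and so is
-- (x..c) (its ends lie in F). In each permutation x lies strictly inside the block of (a..y)
-- and y strictly inside the block of (x..c); as every value occurs once, the two blocks
-- cannot have opposite orientations (x would come both before and after y), so they overlap
-- and their common part is a block delimited by x and y with value set
-- (a..y) ∩ (x..c) = (x..y).
module Submission where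

open import Defs
open import Data.Nat using (ℕ; _+_; _∸_; _≤_; _<_; s≤s; s≤s⁻¹)
open import Data.Nat.Properties
open import Data.Bool using (true; false)
open import Data.Product using (_×_; _,_; proj₁; proj₂; ∃-syntax; swap)
open import Data.Product.Function.NonDependent.Propositional using (_×-⇔_)
open import Data.Sum as Sum using (_⊎_; inj₁; inj₂)
open import Data.Empty using (⊥; ⊥-elim)
open import Data.List using (List; []; _∷_; _++_; [_]; map)
open import Data.List.Properties using (++-assoc; map-++; ∷-injective)
open import Data.List.Membership.Propositional using (_∈_)
open import Data.List.Membership.Propositional.Properties
  using (∈-map⁻; ∈-map⁺; ∈-upTo⁻; ∈-upTo⁺; ∈-++⁺ˡ; ∈-++⁺ʳ; ∈-++⁻; ∈-∃++)
open import Data.List.Membership.Propositional.Properties.WithK using (unique∧set⇒bag)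
open import Data.List.Relation.Unary.Any using (here; there)
open import Data.List.Relation.Unary.All as All using (All)
import Data.List.Relation.Unary.All.Properties as All
open import Data.List.Relation.Unary.AllPairs using ([]; _∷_)
open import Data.List.Relation.Unary.Unique.Propositional as Unique using (Unique)
import Data.List.Relation.Unary.Unique.Propositional.Properties as Unique
open import Data.List.Relation.Binary.Permutation.Propositional using (_↭_; ↭-sym; ↭⇒↭ₛ)
open import Data.List.Relation.Binary.Permutation.Propositional.Properties using (∈-resp-↭)
import Data.List.Relation.Binary.Permutation.Setoid.Properties as Permutationₛ
open import Data.List.Relation.Binary.BagAndSetEquality using (∼bag⇒↭)
open import Function using (_∘_)
open import Function.Bundles using (_⇔_; mk⇔)
open import Function.Properties.Equivalence using () renaming (sym to ⇔-sym; trans to ⇔-trans)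
open import Relation.Binary.PropositionalEquality
  using (_≡_; _≢_; refl; sym; trans; cong; subst; setoid; module ≡-Reasoning)

private
  variable
    A : Set
    n : ℕ
    𝒫 : List (List SElt)
    F G : ℕ → Set
    a c i j v x y : ℕ
    R R₁ R₂ : List ℕ
    e e′ l l₁ l₂ r r₁ r₂ : SElt
    P p p′ p₁ p₂ m m₁ m₂ s s′ s₁ s₂ : List SElt

∈-range⁻ : a ≤ c → v ∈ range a c → a ≤ v × v ≤ c
∈-range⁻ {a} {c} a≤c v∈ with i , i∈ , refl ← ∈-map⁻ (a +_) v∈ =
  m≤m+n a i , (begin
    a + i       ≤⟨ +-monoʳ-≤ a (s≤s⁻¹ (∈-upTo⁻ i∈)) ⟩
    a + (c ∸ a) ≡⟨ m+[n∸m]≡n a≤c ⟩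
    c           ∎)
  where open ≤-Reasoning

∈-range⁺ : a ≤ v → v ≤ c → v ∈ range a c
∈-range⁺ {a} {v} {c} a≤v v≤c =
  subst (_∈ range a c) (m+[n∸m]≡n a≤v) (∈-map⁺ (a +_) (∈-upTo⁺ (s≤s (∸-monoˡ-≤ a v≤c))))

range-unique : ∀ a c → Unique (range a c)
range-unique a c = Unique.map⁺ (+-cancelˡ-≡ a _ _) (Unique.upTo⁺ _)

range-∩ : a ≤ x → x ≤ y → y ≤ c → v ∈ range x y ⇔ (v ∈ range a y × v ∈ range x c)
range-∩ a≤x x≤y y≤c = mk⇔ to from
  where
  to : _ ∈ range _ _ → _
  to v∈ = let x≤v , v≤y = ∈-range⁻ x≤y v∈ in
    ∈-range⁺ (≤-trans a≤x x≤v) v≤y , ∈-range⁺ x≤v (≤-trans v≤y y≤c)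
  from : _ → _ ∈ range _ _
  from (v∈ay , v∈xc) =
    ∈-range⁺ (proj₁ (∈-range⁻ (≤-trans x≤y y≤c) v∈xc)) (proj₂ (∈-range⁻ (≤-trans a≤x x≤y) v∈ay))

Unique-++⁻ˡ : ∀ (xs : List A) {ys} → Unique (xs ++ ys) → Unique xs
Unique-++⁻ˡ []       _          = []
Unique-++⁻ˡ (_ ∷ xs) (x∉ ∷ xs!) = All.++⁻ˡ xs x∉ ∷ Unique-++⁻ˡ xs xs!

Unique-++⁻ʳ : ∀ (xs : List A) {ys} → Unique (xs ++ ys) → Unique ys
Unique-++⁻ʳ []       ys!       = ys!
Unique-++⁻ʳ (_ ∷ xs) (_ ∷ xs!) = Unique-++⁻ʳ xs xs!

Unique-++-disjoint : ∀ (xs : List A) {ys} {z : A} → Unique (xs ++ ys) → z ∈ xs → z ∈ ys → ⊥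
Unique-++-disjoint (_ ∷ xs) (x∉ ∷ _)  (here refl) z∈ys = All.lookup x∉ (∈-++⁺ʳ xs z∈ys) refl
Unique-++-disjoint (_ ∷ xs) (_ ∷ xs!) (there z∈xs) z∈ys = Unique-++-disjoint xs xs! z∈xs z∈ys

↭⇒∈⇔ : {xs ys : List A} {z : A} → xs ↭ ys → z ∈ xs ⇔ z ∈ ys
↭⇒∈⇔ xs↭ys = mk⇔ (∈-resp-↭ xs↭ys) (∈-resp-↭ (↭-sym xs↭ys))

vals : List SElt → List ℕ
vals = map proj₂

span : SElt → List SElt → SElt → List SElt
span l m r = l ∷ m ++ [ r ]

vals-++ : ∀ p s → vals (p ++ s) ≡ vals p ++ vals s
vals-++ = map-++ proj₂

∈-vals-++⁺ˡ : ∀ p {s} → v ∈ vals p → v ∈ vals (p ++ s)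
∈-vals-++⁺ˡ p {s} v∈ rewrite vals-++ p s = ∈-++⁺ˡ v∈

∈-vals-++⁺ʳ : ∀ p {s} → v ∈ vals s → v ∈ vals (p ++ s)
∈-vals-++⁺ʳ p {s} v∈ rewrite vals-++ p s = ∈-++⁺ʳ (vals p) v∈

∈-vals-++⁻ : ∀ p {s} → v ∈ vals (p ++ s) → v ∈ vals p ⊎ v ∈ vals s
∈-vals-++⁻ p {s} v∈ rewrite vals-++ p s = ∈-++⁻ (vals p) v∈

Unique-vals-++⁻ˡ : ∀ p {s} → Unique (vals (p ++ s)) → Unique (vals p)
Unique-vals-++⁻ˡ p {s} u rewrite vals-++ p s = Unique-++⁻ˡ (vals p) u

Unique-vals-++⁻ʳ : ∀ p {s} → Unique (vals (p ++ s)) → Unique (vals s)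
Unique-vals-++⁻ʳ p {s} u rewrite vals-++ p s = Unique-++⁻ʳ (vals p) u

Unique-vals-++-disjoint : ∀ p {s} → Unique (vals (p ++ s)) → v ∈ vals p → v ∈ vals s → ⊥
Unique-vals-++-disjoint p {s} u rewrite vals-++ p s = Unique-++-disjoint (vals p) u

∈-vals⇒split : v ∈ vals m → ∃[ u ] ∃[ e ] ∃[ w ] m ≡ u ++ e ∷ w × proj₂ e ≡ v
∈-vals⇒split v∈ with e , e∈ , refl ← ∈-map⁻ proj₂ v∈ with u , w , m≡ ← ∈-∃++ e∈ =
  u , e , w , m≡ , refl

Unique-vals-suffix : Unique (vals P) → P ≡ p ++ e ∷ s → Unique (vals s)
Unique-vals-suffix {p = p} P! refl = Unique.tail (Unique-vals-++⁻ʳ p P!)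

split-unique-val : ∀ p p′ → Unique (vals P) → P ≡ p ++ e ∷ s → P ≡ p′ ++ e′ ∷ s′ →
                   proj₂ e ≡ proj₂ e′ → p ≡ p′ × e ≡ e′ × s ≡ s′
split-unique-val []      []       _  refl refl _    = refl , refl , refl
split-unique-val []      (_ ∷ p′) P! refl refl e≡e′ =
  ⊥-elim (All.lookup (Unique.head P!) (∈-vals-++⁺ʳ p′ (here refl)) e≡e′)
split-unique-val (_ ∷ p) []       P! refl refl e≡e′ =
  ⊥-elim (All.lookup (Unique.head P!) (∈-vals-++⁺ʳ p (here refl)) (sym e≡e′))
split-unique-val (_ ∷ p) (_ ∷ p′) P! refl eq   e≡e′
  with refl , eq′ ← ∷-injective eq
  with refl , refl , refl ← split-unique-val p p′ (Unique.tail P!) refl eq′ e≡e′ = refl , refl , refl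

span-++ : ∀ l m r s → span l m r ++ s ≡ l ∷ m ++ r ∷ s
span-++ l m r s = cong (l ∷_) (++-assoc m [ r ] s)

inner-split : ∀ (p : List A) l (u : List A) e w r s →
              p ++ l ∷ (u ++ e ∷ w) ++ r ∷ s ≡ (p ++ l ∷ u) ++ e ∷ w ++ r ∷ s
inner-split p l u e w r s = begin
  p ++ l ∷ (u ++ e ∷ w) ++ r ∷ s  ≡⟨ cong (λ t → p ++ l ∷ t) (++-assoc u (e ∷ w) (r ∷ s)) ⟩
  p ++ l ∷ u ++ e ∷ w ++ r ∷ s    ≡⟨ ++-assoc p (l ∷ u) (e ∷ w ++ r ∷ s) ⟨
  (p ++ l ∷ u) ++ e ∷ w ++ r ∷ s  ∎
  where open ≡-Reasoning

span-unique : Unique (vals P) → P ≡ p ++ l ∷ m ++ r ∷ s → Unique (vals (span l m r))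
span-unique {p = p} {l} {m} {r} {s} P! refl =
  Unique-vals-++⁻ˡ (span l m r) (subst (Unique ∘ vals) (sym (span-++ l m r s)) (Unique-vals-++⁻ʳ p P!))

span-prefix-disjoint : Unique (vals P) → P ≡ p ++ l ∷ m ++ r ∷ s →
                       v ∈ vals p → v ∈ vals (span l m r) → ⊥
span-prefix-disjoint {p = p} {l} {m} {r} {s} {v} P! refl v∈p v∈span =
  Unique-vals-++-disjoint p P! v∈p
    (subst ((v ∈_) ∘ vals) (span-++ l m r s) (∈-vals-++⁺ˡ (span l m r) v∈span))

Delimits : ℕ → ℕ → SElt → SElt → Set
Delimits a c l r = (l ≡ (true , a) × r ≡ (true , c)) ⊎ (l ≡ (false , c) × r ≡ (false , a))

delimiter-value : Delimits i j l r → (proj₂ l ≡ i ⊎ proj₂ l ≡ j) × (proj₂ r ≡ j ⊎ proj₂ r ≡ i)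
delimiter-value (inj₁ (refl , refl)) = inj₁ refl , inj₁ refl
delimiter-value (inj₂ (refl , refl)) = inj₂ refl , inj₂ refl

between⇒≢-ends : i < v → v < j → x ≡ i ⊎ x ≡ j → v ≢ x
between⇒≢-ends i<v _   (inj₁ x≡i) v≡x = <⇒≢ i<v (sym (trans v≡x x≡i))
between⇒≢-ends _   v<j (inj₂ x≡j) v≡x = <⇒≢ v<j (trans v≡x x≡j)

∈-interior : vals (span l m r) ↭ range i j → Delimits i j l r → i < v → v < j → v ∈ vals m
∈-interior {m = m} span↭ ends i<v v<j
  with ∈-resp-↭ (↭-sym span↭) (∈-range⁺ (<⇒≤ i<v) (<⇒≤ v<j))
... | here v≡l = ⊥-elim (between⇒≢-ends i<v v<j (proj₁ (delimiter-value ends)) v≡l)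
... | there v∈ with ∈-vals-++⁻ m v∈
...   | inj₁ v∈m        = v∈m
...   | inj₂ (here v≡r) = ⊥-elim (between⇒≢-ends i<v v<j (Sum.swap (proj₂ (delimiter-value ends))) v≡r)

Precedes : List SElt → ℕ → ℕ → Set
Precedes P x y = ∃[ p ] ∃[ e ] ∃[ m ] ∃[ e′ ] ∃[ s ]
  P ≡ p ++ e ∷ m ++ e′ ∷ s × proj₂ e ≡ x × proj₂ e′ ≡ y

Precedes-asym : Unique (vals P) → Precedes P x y → Precedes P y x → ⊥
Precedes-asym P! (p , e , m , f , s , eq , refl , refl) (p′ , f′ , m′ , e′ , s′ , eq′ , f′≡f , e′≡e)
  with refl , _ , _ ← split-unique-val p (p′ ++ f′ ∷ m′) P! eq
                        (trans eq′ (sym (++-assoc p′ (f′ ∷ m′) (e′ ∷ s′)))) (sym e′≡e)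
  = Unique-vals-++-disjoint (p′ ++ f′ ∷ m′) (subst (Unique ∘ vals) eq P!)
      (∈-vals-++⁺ʳ p′ (here (sym f′≡f))) (there (∈-vals-++⁺ʳ m (here refl)))

span-left-precedes : P ≡ p ++ l ∷ m ++ r ∷ s → v ∈ vals m → Precedes P (proj₂ l) v
span-left-precedes {p = p} {l} {r = r} {s} refl v∈m with u , e , w , refl , refl ← ∈-vals⇒split v∈m =
  p , l , u , e , w ++ r ∷ s , cong (λ t → p ++ l ∷ t) (++-assoc u (e ∷ w) (r ∷ s)) , refl , refl

span-precedes-right : P ≡ p ++ l ∷ m ++ r ∷ s → v ∈ vals m → Precedes P v (proj₂ r)
span-precedes-right {p = p} {l} {r = r} {s} refl v∈m with u , e , w , refl , refl ← ∈-vals⇒split v∈m =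
  p ++ l ∷ u , e , w , r , s , inner-split p l u e w r s , refl , refl

spans-overlap : Unique (vals P) → P ≡ p₁ ++ l₁ ∷ m₁ ++ r₁ ∷ s₁ → P ≡ p₂ ++ l₂ ∷ m₂ ++ r₂ ∷ s₂ →
  proj₂ l₂ ∈ vals m₁ → proj₂ r₁ ∈ vals m₂ →
  ∃[ u ] ∃[ m ] ∃[ w ] p₂ ≡ p₁ ++ l₁ ∷ u × m₁ ≡ u ++ l₂ ∷ m × m₂ ≡ m ++ r₁ ∷ w
spans-overlap {p₁ = p₁} {l₁} {r₁ = r₁} {s₁} {p₂} {r₂ = r₂} {s₂} P! eq₁ eq₂ l₂∈m₁ r₁∈m₂
  with u , e , w , refl , e≡l₂ ← ∈-vals⇒split l₂∈m₁
  with refl , refl , tail≡ ← split-unique-val (p₁ ++ l₁ ∷ u) p₂ P!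
                               (trans eq₁ (inner-split p₁ l₁ u e w r₁ s₁)) eq₂ e≡l₂
  with u′ , e′ , w′ , refl , e′≡r₁ ← ∈-vals⇒split r₁∈m₂
  with refl , refl , refl ← split-unique-val w u′ (Unique-vals-suffix P! eq₂)
                              (sym tail≡) (++-assoc u′ (e′ ∷ w′) (r₂ ∷ s₂)) (sym e′≡r₁)
  = u , w , w′ , refl , refl , refl

overlap-∈⇔ : ∀ p₁ u m w → Unique (vals P) →
  P ≡ (p₁ ++ l₁ ∷ u) ++ l₂ ∷ (m ++ r₁ ∷ w) ++ r₂ ∷ s₂ →
  v ∈ vals (span l₂ m r₁) ⇔ (v ∈ vals (span l₁ (u ++ l₂ ∷ m) r₁) × v ∈ vals (span l₂ (m ++ r₁ ∷ w) r₂))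
overlap-∈⇔ {l₁ = l₁} {l₂} {r₁} {r₂} {v = v} p₁ u m w P! eq = mk⇔ to from
  where
  seg : List SElt
  seg = span l₂ m r₁
  left : span l₁ (u ++ l₂ ∷ m) r₁ ≡ (l₁ ∷ u) ++ seg
  left = cong (l₁ ∷_) (++-assoc u (l₂ ∷ m) [ r₁ ])
  right : span l₂ (m ++ r₁ ∷ w) r₂ ≡ seg ++ w ++ [ r₂ ]
  right = cong (l₂ ∷_) (trans (++-assoc m (r₁ ∷ w) [ r₂ ]) (sym (++-assoc m [ r₁ ] (w ++ [ r₂ ]))))
  to : v ∈ vals seg → _
  to v∈ = subst ((v ∈_) ∘ vals) (sym left) (∈-vals-++⁺ʳ (l₁ ∷ u) v∈)
        , subst ((v ∈_) ∘ vals) (sym right) (∈-vals-++⁺ˡ seg v∈)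
  from : _ → v ∈ vals seg
  from (v∈₁ , v∈₂) with ∈-vals-++⁻ (l₁ ∷ u) (subst ((v ∈_) ∘ vals) left v∈₁)
  ... | inj₂ v∈seg = v∈seg
  ... | inj₁ v∈lu  = ⊥-elim (span-prefix-disjoint P! eq (∈-vals-++⁺ʳ p₁ v∈lu) v∈₂)

span-∩ : Unique (vals P) →
  P ≡ p₁ ++ l₁ ∷ m₁ ++ r₁ ∷ s₁ → vals (span l₁ m₁ r₁) ↭ R₁ →
  P ≡ p₂ ++ l₂ ∷ m₂ ++ r₂ ∷ s₂ → vals (span l₂ m₂ r₂) ↭ R₂ →
  proj₂ l₂ ∈ vals m₁ → proj₂ r₁ ∈ vals m₂ →
  Unique R → (∀ {v} → v ∈ R ⇔ (v ∈ R₁ × v ∈ R₂)) →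
  ∃[ m ] P ≡ p₂ ++ l₂ ∷ m ++ r₁ ∷ s₁ × vals (span l₂ m r₁) ↭ R
span-∩ {p₁ = p₁} {l₁} {r₁ = r₁} {s₁} {l₂ = l₂} P! eq₁ ↭₁ eq₂ ↭₂ l₂∈m₁ r₁∈m₂ R! R⇔
  with u , m , w , refl , refl , refl ← spans-overlap P! eq₁ eq₂ l₂∈m₁ r₁∈m₂
  with eq ← trans eq₁ (inner-split p₁ l₁ u l₂ m r₁ s₁)
  = m , eq , ∼bag⇒↭ (unique∧set⇒bag (span-unique P! eq) R!
                      (⇔-trans (overlap-∈⇔ p₁ u m w P! eq₂) (⇔-trans (↭⇒∈⇔ ↭₁ ×-⇔ ↭⇒∈⇔ ↭₂) (⇔-sym R⇔))))

BlockIn-∩ : Unique (vals P) → a < x → x < y → y < c → BlockIn a y P → BlockIn x c P → BlockIn x y P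
BlockIn-∩ P! a<x x<y y<c (_  , _ , _ , _ , _ , eqA , A↭ , oA@(inj₁ (refl , refl)))
                         (pB , _ , _ , _ , _ , eqB , B↭ , oB@(inj₁ (refl , refl)))
  with m , eq , ↭xy ← span-∩ P! eqA A↭ eqB B↭ (∈-interior A↭ oA a<x x<y) (∈-interior B↭ oB x<y y<c)
                        (range-unique _ _) (range-∩ (<⇒≤ a<x) (<⇒≤ x<y) (<⇒≤ y<c))
  = pB , _ , m , _ , _ , eq , ↭xy , inj₁ (refl , refl)
BlockIn-∩ P! a<x x<y y<c (pA , _ , _ , _ , _ , eqA , A↭ , oA@(inj₂ (refl , refl)))
                         (_  , _ , _ , _ , _ , eqB , B↭ , oB@(inj₂ (refl , refl)))
  with m , eq , ↭xy ← span-∩ P! eqB B↭ eqA A↭ (∈-interior B↭ oB x<y y<c) (∈-interior A↭ oA a<x x<y)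
                        (range-unique _ _) (⇔-trans (range-∩ (<⇒≤ a<x) (<⇒≤ x<y) (<⇒≤ y<c)) (mk⇔ swap swap))
  = pA , _ , m , _ , _ , eq , ↭xy , inj₂ (refl , refl)
BlockIn-∩ P! a<x x<y y<c (_ , _ , _ , _ , _ , eqA , A↭ , oA@(inj₁ (refl , refl)))
                         (_ , _ , _ , _ , _ , eqB , B↭ , oB@(inj₂ (refl , refl))) =
  ⊥-elim (Precedes-asym P! (span-precedes-right eqA (∈-interior A↭ oA a<x x<y))
                           (span-precedes-right eqB (∈-interior B↭ oB x<y y<c)))
BlockIn-∩ P! a<x x<y y<c (_ , _ , _ , _ , _ , eqA , A↭ , oA@(inj₂ (refl , refl)))
                         (_ , _ , _ , _ , _ , eqB , B↭ , oB@(inj₁ (refl , refl))) =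
  ⊥-elim (Precedes-asym P! (span-left-precedes eqB (∈-interior B↭ oB x<y y<c))
                           (span-left-precedes eqA (∈-interior A↭ oA a<x x<y)))

Conserved⇒BlockIn : a < c → Conserved n 𝒫 a c → All (BlockIn a c) 𝒫
Conserved⇒BlockIn a<c (inj₁ (refl , _)) = ⊥-elim (<-irrefl refl a<c)
Conserved⇒BlockIn _   (inj₂ (_ , blocks)) = blocks

Conserved-∩ : All (Unique ∘ vals) 𝒫 → a ≤ x → x < y → y ≤ c →
              Conserved n 𝒫 a y → Conserved n 𝒫 x c → Conserved n 𝒫 x y
Conserved-∩ 𝒫! a≤x x<y y≤c Cay Cxc with m≤n⇒m<n∨m≡n a≤x | m≤n⇒m<n∨m≡n y≤c
... | inj₂ refl | _         = Cay
... | inj₁ _    | inj₂ refl = Cxc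
... | inj₁ a<x  | inj₁ y<c  =
  inj₂ (x<y , All.zipWith (λ (P! , A , B) → BlockIn-∩ P! a<x x<y y<c A B)
                          (𝒫! , All.zip ( Conserved⇒BlockIn (<-trans a<x x<y) Cay
                                        , Conserved⇒BlockIn (<-trans x<y y<c) Cxc)))

frontiers-cross : All (Unique ∘ vals) 𝒫 → IsFrontierSet n 𝒫 a c F → IsFrontierSet n 𝒫 a c G →
                  F x → G y → x < y → Conserved n 𝒫 x y
frontiers-cross {x = x} {y} 𝒫! (_ , Fc , F⊆ , F-conserved) (Ga , _ , G⊆ , G-conserved) Fx Gy x<y =
  Conserved-∩ 𝒫! a≤x x<y y≤c (G-conserved _ y Ga Gy (≤-<-trans a≤x x<y))
                             (F-conserved x _ Fx Fc (<-≤-trans x<y y≤c))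
  where
  a≤x : _ ≤ x
  a≤x = proj₁ (F⊆ x Fx)
  y≤c : y ≤ _
  y≤c = proj₂ (G⊆ y Gy)

IsFrontierSet-∪ : All (Unique ∘ vals) 𝒫 → IsFrontierSet n 𝒫 a c F → IsFrontierSet n 𝒫 a c G →
                  IsFrontierSet n 𝒫 a c (F ∪ G)
IsFrontierSet-∪ {𝒫 = 𝒫} {n = n} {F = F} {G = G} 𝒫!
                F-frontiers@(Fa , Fc , F⊆ , F-conserved) G-frontiers@(_ , _ , G⊆ , G-conserved) =
  inj₁ Fa , inj₁ Fc , (λ x → Sum.[ F⊆ x , G⊆ x ]) , conserved
  where
  conserved : ∀ x y → (F ∪ G) x → (F ∪ G) y → x < y → Conserved n 𝒫 x y
  conserved x y (inj₁ Fx) (inj₁ Fy) = F-conserved x y Fx Fy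
  conserved x y (inj₂ Gx) (inj₂ Gy) = G-conserved x y Gx Gy
  conserved x y (inj₁ Fx) (inj₂ Gy) = frontiers-cross 𝒫! F-frontiers G-frontiers Fx Gy
  conserved x y (inj₂ Gx) (inj₁ Fy) = frontiers-cross 𝒫! G-frontiers F-frontiers Gx Fy

IsSignedPerm⇒Unique : IsSignedPerm n P → Unique (vals P)
IsSignedPerm⇒Unique {n} (vals↭ , _) =
  Permutationₛ.Unique-resp-↭ (setoid ℕ) (↭⇒↭ₛ (↭-sym vals↭)) (range-unique 1 n)

-- Only the distinctness of values in each permutation is used.
lemma7 : (n : ℕ) → 2 ≤ n → (rest : List (List SElt)) →
    All (IsSignedPerm n) (Id n ∷ rest) →
    (a c : ℕ) → Conserved n (Id n ∷ rest) a c →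
    (F F′ : ℕ → Set) →
    IsFrontierSet n (Id n ∷ rest) a c F →
    IsFrontierSet n (Id n ∷ rest) a c F′ →
    IsFrontierSet n (Id n ∷ rest) a c (F ∪ F′)
lemma7 _ _ _ signed _ _ _ _ _ = IsFrontierSet-∪ (All.map IsSignedPerm⇒Unique signed)
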